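{- Let $G$ be a finite simple graph that is not quasi-regularizable, and let $S_0$ be a stable set of $G$ with $|S_0|>|N(S_0)|$ whose cardinality is minimum among all stable sets $S$ of $G$ satisfying $|S|>|N(S)|$. Then $S_0\subseteq core(G)$.
   Context: $G$ is quasi-regularizable if one can replace each edge of $G$ by a non-negative integer number of parallel copies so as to obtain a regular multigraph of nonzero degree. For $A\subseteq V(G)$, $N(A)$ is the set of vertices adjacent to some vertex of $A$. $\Omega(G)$ is the set of maximum stable sets and $core(G)=\bigcap\{S:S\in\Omega(G)\}$. -}

module Defs where

open import Data.Nat using (ℕ; zero; suc; _<_)
open import Data.Bool using (Bool; true; false; T; _∧_)
open import Data.Fin using (Fin)
open import Data.Fin.Subset using (Subset; _∈_; _⊆_; ∣_∣; inside; outside)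
open import Data.Vec using (tabulate; sum)
open import Data.Vec.Relation.Unary.Any using (any?)
open import Data.Product using (Σ; _×_; ∃)
open import Relation.Nullary using (¬_)
open import Relation.Nullary.Decidable using (⌊_⌋)
open import Relation.Binary.PropositionalEquality using (_≡_)

record Graph (n : ℕ) : Set where
  field
    adj   : Fin n → Fin n → Bool
    sym   : ∀ i j → adj i j ≡ adj j i
    irrfl : ∀ i → adj i i ≡ false
open Graph public

adjTo : ∀ {n} → Graph n → Subset n → Fin n → Bool
adjTo G A v = ⌊ any? (λ b → T? b) (tabulate (λ u → memb u A ∧ adj G v u)) ⌋
  where
  open import Data.Bool using (T?)
  open import Data.Vec using (lookup)
  memb : Fin _ → Subset _ → Bool
  memb u A = lookup A u

N : ∀ {n} → Graph n → Subset n → Subset n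
N G A = tabulate (adjTo G A)

Stable : ∀ {n} → Graph n → Subset n → Set
Stable G S = ∀ u v → u ∈ S → v ∈ S → adj G u v ≡ false

Maximum : ∀ {n} → Graph n → Subset n → Set
Maximum G S = Stable G S × (∀ T → Stable G T → ∣ T ∣ Data.Nat.≤ ∣ S ∣)
  where import Data.Nat

InCore : ∀ {n} → Graph n → Fin n → Set
InCore G v = ∀ S → Maximum G S → v ∈ S

SubsetOfCore : ∀ {n} → Graph n → Subset n → Set
SubsetOfCore G S = ∀ v → v ∈ S → InCore G v

wdeg : ∀ {n} → (Fin n → Fin n → ℕ) → Fin n → ℕ
wdeg w i = sum (tabulate (w i))

-- G is quasi-regularizable: each edge replaced by a non-negative number of
-- parallel copies (w), non-edges get none, giving a d-regular multigraph, d > 0.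
QuasiRegularizable : ∀ {n} → Graph n → Set
QuasiRegularizable {n} G =
  Σ (Fin n → Fin n → ℕ) λ w →
    (∀ i j → w i j ≡ w j i) ×
    (∀ i j → adj G i j ≡ false → w i j ≡ 0) ×
    Σ ℕ λ d → (0 < d) × (∀ i → wdeg w i ≡ d)

{-# OPTIONS --safe #-}
-- If a vertex v ∈ S₀ is missed by a maximum stable set S, split S₀ into
-- X = S₀ ∩ S and Y = S₀ ∖ S ∋ v.  Replacing S ∩ N(Y) by Y in S gives the
-- stable set Y ∪ (S ∖ N(Y)), so maximality of S yields |Y| ≤ |S ∩ N(Y)|.
-- As N(X) and S ∩ N(Y) are disjoint parts of N(S₀),
--   |N(X)| + |S ∩ N(Y)| ≤ |N(S₀)| < |S₀| = |X| + |Y| ≤ |X| + |S ∩ N(Y)|,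
-- so X is a strictly smaller stable set with |N(X)| < |X|.
module Submission where

open import Defs hiding (sym)
open import Data.Nat using (ℕ; suc; _<_; _≤_; _+_)
open import Data.Nat.Properties
  using (+-suc; +-identityʳ; <⇒≱; +-cancelʳ-≤; +-cancelʳ-<; +-monoʳ-≤; module ≤-Reasoning)
open import Data.Bool using (true; false)
open import Data.Bool.Properties using (T-≡; T-∧)
open import Data.Fin.Subset
  using (Subset; ∣_∣; _∈_; _∉_; _⊆_; _∩_; _∪_; ∁; ⊥; Empty; inside; outside)
open import Data.Fin.Subset.Properties
  using ( _∈?_; x∈p∩q⁺; x∈p∩q⁻; x∈p∪q⁻; x∈∁p⇒x∉p; p∩q⊆p; p∩q⊆q
        ; p⊆q⇒∣p∣≤∣q∣; p⊂q⇒∣p∣<∣q∣; Empty-unique; ∣⊥∣≡0)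
open import Data.Vec using ([]; _∷_)
open import Data.Vec.Properties using ([]=⇒lookup; lookup⇒[]=; lookup∘tabulate)
open import Data.Vec.Relation.Unary.Any.Properties using (tabulate⁺; tabulate⁻)
open import Data.Product using (∃; _×_; _,_; proj₁; proj₂)
open import Data.Sum using (inj₁; inj₂)
open import Function using (_∘_)
open import Function.Bundles using (Equivalence; _⇔_; mk⇔)
open import Relation.Nullary using (¬_; yes; no; contradiction)
open import Relation.Nullary.Decidable using (toWitness; fromWitness)
open import Relation.Binary.PropositionalEquality
  using (_≡_; refl; sym; trans; cong; subst; module ≡-Reasoning)

private
  variable
    n : ℕ

∣p∪q∣+∣p∩q∣≡∣p∣+∣q∣ : ∀ (p q : Subset n) → ∣ p ∪ q ∣ + ∣ p ∩ q ∣ ≡ ∣ p ∣ + ∣ q ∣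
∣p∪q∣+∣p∩q∣≡∣p∣+∣q∣ []            []            = refl
∣p∪q∣+∣p∩q∣≡∣p∣+∣q∣ (inside  ∷ p) (inside  ∷ q) = cong suc (begin
  ∣ p ∪ q ∣ + suc ∣ p ∩ q ∣   ≡⟨ +-suc ∣ p ∪ q ∣ ∣ p ∩ q ∣ ⟩
  suc (∣ p ∪ q ∣ + ∣ p ∩ q ∣) ≡⟨ cong suc (∣p∪q∣+∣p∩q∣≡∣p∣+∣q∣ p q) ⟩
  suc (∣ p ∣ + ∣ q ∣)         ≡⟨ +-suc ∣ p ∣ ∣ q ∣ ⟨
  ∣ p ∣ + suc ∣ q ∣           ∎)
  where open ≡-Reasoning
∣p∪q∣+∣p∩q∣≡∣p∣+∣q∣ (inside  ∷ p) (outside ∷ q) = cong suc (∣p∪q∣+∣p∩q∣≡∣p∣+∣q∣ p q)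
∣p∪q∣+∣p∩q∣≡∣p∣+∣q∣ (outside ∷ p) (inside  ∷ q) =
  trans (cong suc (∣p∪q∣+∣p∩q∣≡∣p∣+∣q∣ p q)) (sym (+-suc ∣ p ∣ ∣ q ∣))
∣p∪q∣+∣p∩q∣≡∣p∣+∣q∣ (outside ∷ p) (outside ∷ q) = ∣p∪q∣+∣p∩q∣≡∣p∣+∣q∣ p q

∣p∩q∣+∣p∩∁q∣≡∣p∣ : ∀ (p q : Subset n) → ∣ p ∩ q ∣ + ∣ p ∩ ∁ q ∣ ≡ ∣ p ∣
∣p∩q∣+∣p∩∁q∣≡∣p∣ []            []            = refl
∣p∩q∣+∣p∩∁q∣≡∣p∣ (inside  ∷ p) (inside  ∷ q) = cong suc (∣p∩q∣+∣p∩∁q∣≡∣p∣ p q)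
∣p∩q∣+∣p∩∁q∣≡∣p∣ (inside  ∷ p) (outside ∷ q) =
  trans (+-suc ∣ p ∩ q ∣ ∣ p ∩ ∁ q ∣) (cong suc (∣p∩q∣+∣p∩∁q∣≡∣p∣ p q))
∣p∩q∣+∣p∩∁q∣≡∣p∣ (outside ∷ p) (_       ∷ q) = ∣p∩q∣+∣p∩∁q∣≡∣p∣ p q

p∩q≡∅⇒∣p∪q∣≡∣p∣+∣q∣ : ∀ {p q : Subset n} → Empty (p ∩ q) → ∣ p ∪ q ∣ ≡ ∣ p ∣ + ∣ q ∣
p∩q≡∅⇒∣p∪q∣≡∣p∣+∣q∣ {n} {p} {q} p∩q≡∅ = begin
  ∣ p ∪ q ∣                  ≡⟨ +-identityʳ ∣ p ∪ q ∣ ⟨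
  ∣ p ∪ q ∣ + 0              ≡⟨ cong (∣ p ∪ q ∣ +_) (∣⊥∣≡0 n) ⟨
  ∣ p ∪ q ∣ + ∣ ⊥ {n = n} ∣  ≡⟨ cong (λ r → ∣ p ∪ q ∣ + ∣ r ∣) (Empty-unique p∩q≡∅) ⟨
  ∣ p ∪ q ∣ + ∣ p ∩ q ∣      ≡⟨ ∣p∪q∣+∣p∩q∣≡∣p∣+∣q∣ p q ⟩
  ∣ p ∣ + ∣ q ∣              ∎
  where open ≡-Reasoning

p∩q≡∅⇒∣p∣+∣q∣≤∣r∣ : ∀ {p q r : Subset n} → Empty (p ∩ q) → p ⊆ r → q ⊆ r → ∣ p ∣ + ∣ q ∣ ≤ ∣ r ∣
p∩q≡∅⇒∣p∣+∣q∣≤∣r∣ {p = p} {q} p∩q≡∅ p⊆r q⊆r =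
  subst (_≤ _) (p∩q≡∅⇒∣p∪q∣≡∣p∣+∣q∣ p∩q≡∅) (p⊆q⇒∣p∣≤∣q∣ p∪q⊆r)
  where
  p∪q⊆r : p ∪ q ⊆ _
  p∪q⊆r x∈p∪q with x∈p∪q⁻ p q x∈p∪q
  ... | inj₁ x∈p = p⊆r x∈p
  ... | inj₂ x∈q = q⊆r x∈q

module _ (G : Graph n) where

  ∈N⇔adjTo : ∀ {A u} → u ∈ N G A ⇔ adjTo G A u ≡ true
  ∈N⇔adjTo {A} {u} = mk⇔
    (λ u∈NA → trans (sym (lookup∘tabulate (adjTo G A) u)) ([]=⇒lookup u∈NA))
    (λ u~A → lookup⇒[]= u (N G A) (trans (lookup∘tabulate (adjTo G A) u) u~A))

  adj⇒∈N : ∀ {A u v} → v ∈ A → adj G u v ≡ true → u ∈ N G A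
  adj⇒∈N {A} {v = v} v∈A uv = Equivalence.from (∈N⇔adjTo {A})
    (Equivalence.to T-≡ (fromWitness (tabulate⁺ v
      (Equivalence.from T-∧ (Equivalence.from T-≡ ([]=⇒lookup v∈A) , Equivalence.from T-≡ uv)))))

  ∈N⇒adj : ∀ {A u} → u ∈ N G A → ∃ λ v → v ∈ A × adj G u v ≡ true
  ∈N⇒adj {A} u∈NA
    with v , v∈A∧uv ← tabulate⁻ (toWitness (Equivalence.from T-≡ (Equivalence.to (∈N⇔adjTo {A}) u∈NA)))
    with v∈A , uv ← Equivalence.to T-∧ v∈A∧uv
    = v , lookup⇒[]= v A (Equivalence.to T-≡ v∈A) , Equivalence.to T-≡ uv

  ∉N⇒¬adj : ∀ {A u v} → u ∉ N G A → v ∈ A → adj G u v ≡ false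
  ∉N⇒¬adj {u = u} {v} u∉NA v∈A with adj G u v in uv
  ... | true  = contradiction (adj⇒∈N v∈A uv) u∉NA
  ... | false = refl

  N-mono : ∀ {A B} → A ⊆ B → N G A ⊆ N G B
  N-mono A⊆B u∈NA with v , v∈A , uv ← ∈N⇒adj u∈NA = adj⇒∈N (A⊆B v∈A) uv

  Stable-⊆ : ∀ {A B} → A ⊆ B → Stable G B → Stable G A
  Stable-⊆ A⊆B stB u v u∈A v∈A = stB u v (A⊆B u∈A) (A⊆B v∈A)

  Stable⇒N∩≡∅ : ∀ {S A} → Stable G S → A ⊆ S → Empty (N G A ∩ S)
  Stable⇒N∩≡∅ {S} {A} stS A⊆S (u , u∈NA∩S)
    with u∈NA , u∈S ← x∈p∩q⁻ (N G A) S u∈NA∩S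
    with v , v∈A , uv ← ∈N⇒adj u∈NA
    with () ← trans (sym uv) (stS u v u∈S (A⊆S v∈A))

  Stable-exchange : ∀ {S Y} → Stable G S → Stable G Y → Stable G (Y ∪ (S ∩ ∁ (N G Y)))
  Stable-exchange {S} {Y} stS stY u v u∈T v∈T
    with x∈p∪q⁻ Y _ u∈T | x∈p∪q⁻ Y _ v∈T
  ... | inj₁ u∈Y | inj₁ v∈Y = stY u v u∈Y v∈Y
  ... | inj₂ u∈S∖NY | inj₂ v∈S∖NY =
    stS u v (proj₁ (x∈p∩q⁻ S _ u∈S∖NY)) (proj₁ (x∈p∩q⁻ S _ v∈S∖NY))
  ... | inj₁ u∈Y | inj₂ v∈S∖NY =
    trans (Graph.sym G u v) (∉N⇒¬adj (x∈∁p⇒x∉p (proj₂ (x∈p∩q⁻ S _ v∈S∖NY))) u∈Y)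
  ... | inj₂ u∈S∖NY | inj₁ v∈Y = ∉N⇒¬adj (x∈∁p⇒x∉p (proj₂ (x∈p∩q⁻ S _ u∈S∖NY))) v∈Y

  Maximum⇒∣Y∣≤∣S∩NY∣ : ∀ {S Y} → Maximum G S → Stable G Y → Empty (Y ∩ S) → ∣ Y ∣ ≤ ∣ S ∩ N G Y ∣
  Maximum⇒∣Y∣≤∣S∩NY∣ {S} {Y} (stS , maxS) stY Y∩S≡∅ = +-cancelʳ-≤ ∣ S ∩ ∁ (N G Y) ∣ _ _ (begin
    ∣ Y ∣ + ∣ S ∩ ∁ (N G Y) ∣            ≡⟨ p∩q≡∅⇒∣p∪q∣≡∣p∣+∣q∣ Y∩S∖NY≡∅ ⟨
    ∣ Y ∪ (S ∩ ∁ (N G Y)) ∣              ≤⟨ maxS _ (Stable-exchange stS stY) ⟩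
    ∣ S ∣                                ≡⟨ ∣p∩q∣+∣p∩∁q∣≡∣p∣ S (N G Y) ⟨
    ∣ S ∩ N G Y ∣ + ∣ S ∩ ∁ (N G Y) ∣    ∎)
    where
    open ≤-Reasoning
    Y∩S∖NY≡∅ : Empty (Y ∩ (S ∩ ∁ (N G Y)))
    Y∩S∖NY≡∅ (u , u∈Y∩S∖NY) with u∈Y , u∈S∖NY ← x∈p∩q⁻ Y _ u∈Y∩S∖NY =
      Y∩S≡∅ (u , x∈p∩q⁺ (u∈Y , proj₁ (x∈p∩q⁻ S _ u∈S∖NY)))

  Maximum⇒∣N[A∩S]∣<∣A∩S∣ : ∀ {A S} → Stable G A → ∣ N G A ∣ < ∣ A ∣ → Maximum G S →
                          ∣ N G (A ∩ S) ∣ < ∣ A ∩ S ∣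
  Maximum⇒∣N[A∩S]∣<∣A∩S∣ {A} {S} stA deficient maxS@(stS , _) =
    +-cancelʳ-< ∣ S ∩ N G Y ∣ _ _ (begin-strict
      ∣ N G X ∣ + ∣ S ∩ N G Y ∣  ≤⟨ p∩q≡∅⇒∣p∣+∣q∣≤∣r∣ NX∩S∩NY≡∅ (N-mono (p∩q⊆p A S)) S∩NY⊆NA ⟩
      ∣ N G A ∣                  <⟨ deficient ⟩
      ∣ A ∣                      ≡⟨ ∣p∩q∣+∣p∩∁q∣≡∣p∣ A S ⟨
      ∣ X ∣ + ∣ Y ∣              ≤⟨ +-monoʳ-≤ ∣ X ∣ (Maximum⇒∣Y∣≤∣S∩NY∣ maxS stY Y∩S≡∅) ⟩
      ∣ X ∣ + ∣ S ∩ N G Y ∣      ∎)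
    where
    open ≤-Reasoning
    X Y : Subset _
    X = A ∩ S
    Y = A ∩ ∁ S
    stY : Stable G Y
    stY = Stable-⊆ (p∩q⊆p A (∁ S)) stA
    Y∩S≡∅ : Empty (Y ∩ S)
    Y∩S≡∅ (u , u∈Y∩S) with u∈Y , u∈S ← x∈p∩q⁻ Y S u∈Y∩S =
      x∈∁p⇒x∉p (proj₂ (x∈p∩q⁻ A (∁ S) u∈Y)) u∈S
    S∩NY⊆NA : S ∩ N G Y ⊆ N G A
    S∩NY⊆NA u∈S∩NY = N-mono (p∩q⊆p A (∁ S)) (proj₂ (x∈p∩q⁻ S (N G Y) u∈S∩NY))
    NX∩S∩NY≡∅ : Empty (N G X ∩ (S ∩ N G Y))
    NX∩S∩NY≡∅ (u , u∈NX∩S∩NY) with u∈NX , u∈S∩NY ← x∈p∩q⁻ (N G X) _ u∈NX∩S∩NY =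
      Stable⇒N∩≡∅ stS (p∩q⊆q A S) (u , x∈p∩q⁺ (u∈NX , proj₁ (x∈p∩q⁻ S (N G Y) u∈S∩NY)))

lemma2 : ∀ {n : ℕ} (G : Graph n) → ¬ QuasiRegularizable G →
    (S₀ : Subset n) → Stable G S₀ → ∣ N G S₀ ∣ < ∣ S₀ ∣ →
    (∀ (S : Subset n) → Stable G S → ∣ N G S ∣ < ∣ S ∣ → ∣ S₀ ∣ ≤ ∣ S ∣) →
    SubsetOfCore G S₀
lemma2 G _ S₀ stS₀ deficient minimal v v∈S₀ S maxS with v ∈? S
... | yes v∈S = v∈S
... | no  v∉S = contradiction
  (minimal (S₀ ∩ S) (Stable-⊆ G (p∩q⊆p S₀ S) stS₀) (Maximum⇒∣N[A∩S]∣<∣A∩S∣ G stS₀ deficient maxS))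
  (<⇒≱ (p⊂q⇒∣p∣<∣q∣ (p∩q⊆p S₀ S , v , v∈S₀ , v∉S ∘ proj₂ ∘ x∈p∩q⁻ S₀ S)))
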